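{- Let $n$ and $d$ be positive integers, let $q_d$ be the largest prime smaller than $n/d$, and suppose $q_d>n/(d+1)$. Let $\beta_d=n-dq_d$. Let $p^a$ ($p$ prime, $a\ge1$) be a prime power dividing $n$ with $p\ne q_d$. For each integer $\delta$ with $0\le\delta\le\beta_d$, let $N(\delta)$ be the number of integer solutions $(x,y)$ of $p^ax-q_dy=\delta$ with $x>0$ and $0\le y\le\lfloor d/2\rfloor$. Then $n$ satisfies the $N$-variation of Condition 1 with $N=2+\sum_{\delta=0}^{\beta_d}N(\delta)$.
   Context: A positive integer $n$ satisfies the $N$-variation of Condition 1 if there exist $N$ distinct primes such that for every $k$ with $1\le k\le n-1$, $\binom{n}{k}$ is divisible by at least one of them. -}

module Defs where

open import Data.Nat using (ℕ; zero; suc; _+_; _*_; _∸_; _^_; _≤_; _<_; _/_)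
open import Data.Nat.Divisibility using (_∣_)
open import Data.Nat.Primality using (Prime)
open import Data.Nat.Combinatorics using (_C_)
open import Data.List using (List; length; filter; upTo; applyUpTo; cartesianProduct; map)
open import Data.Nat.ListAction using (sum)
open import Data.List.Relation.Unary.All using (All)
open import Data.List.Relation.Unary.Any using (Any)
open import Data.List.Relation.Unary.Unique.Propositional using (Unique)
open import Data.Product using (Σ; _×_; _,_; proj₁; proj₂)
open import Relation.Binary.PropositionalEquality using (_≡_)
open import Data.Integer as ℤ using (ℤ; +_)

Condition1 : ℕ → ℕ → Set
Condition1 N n =
  Σ (List ℕ) λ ps →
    length ps ≡ N × Unique ps × All Prime ps ×
    (∀ k → 1 ≤ k → k ≤ n ∸ 1 → Any (λ r → r ∣ n C k) ps)

-- q is the largest prime smaller than n/d  (q < n/d ⇔ q*d < n)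
IsLargestPrimeBelow : ℕ → ℕ → ℕ → Set
IsLargestPrimeBelow n d q =
  Prime q × q * d < n × (∀ r → Prime r → r * d < n → r ≤ q)

-- N(δ): number of integer solutions (x,y) of  pa*x - q*y = δ  with x > 0 and
-- 0 ≤ y ≤ ⌊d/2⌋.  Every such solution has 1 ≤ x ≤ δ + q*⌊d/2⌋ (since pa ≥ 1
-- and pa*x = δ + q*y), so we count solutions in that finite box.
solutionCount : (pa q d δ : ℕ) → ℕ
solutionCount pa q d δ =
  length (filter (λ xy → (+ pa ℤ.* + proj₁ xy ℤ.- + q ℤ.* + proj₂ xy) ℤ.≟ + δ)
                 (cartesianProduct (applyUpTo suc (δ + q * (d / 2)))
                                   (upTo (suc (d / 2)))))

solutionSum : (pa q d β : ℕ) → ℕ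
solutionSum pa q d β = sum (map (solutionCount pa q d) (upTo (suc β)))

module Submission where

-- Write pa = p^a, h = ⌊d/2⌋ and β = n - d·q, so that
-- n = d·q + β.  The covering primes are p, q and, for every δ ≤ β and every
-- solution (x , y) of pa·x - q·y = δ, one prime factor of C(n, pa·x).  For
-- 1 ≤ k < n write k = j·q + γ with γ < q:
--   * if pa ∤ k, then p ∣ C(n,k), since k·C(n,k) = n·C(n-1,k-1) and pa ∣ n;
--   * if γ > β, then q ∣ C(n,k) (a Lucas-type carry argument);
--   * otherwise pa ∣ k and γ ≤ β; if j ≤ h, then (k/pa , j) is a solution for
--     δ = γ, and if j > h, then n - k = (d-j)·q + (β-γ) with d - j ≤ h is
--     covered in the same way and C(n,k) = C(n,n-k).
-- Finally any list of primes can be replaced by a list of the same length of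
-- pairwise distinct primes containing it (pad with fresh primes).

open import Defs
open import Data.Nat
open import Data.Nat.Properties
open import Data.Nat.Divisibility
open import Data.Nat.DivMod using (m≡m%n+[m/n]*n; m%n<n)
open import Data.Nat.Primality
open import Data.Nat.Primality.Factorisation using (factorise; PrimeFactorisation)
open import Data.Nat.Combinatorics
open import Data.Nat.Combinatorics.Specification using (k>n⇒nCk≡0)
open import Data.Nat.ListAction using (sum; product)
open import Data.Nat.ListAction.Properties using (∈⇒∣product)
open import Data.Nat.Solver using (module +-*-Solver)
open import Data.Integer as ℤ using (+_)
import Data.Integer.Properties as ℤP
open import Data.Empty using (⊥-elim)
open import Data.Sum using (inj₁; inj₂)
open import Data.Product using (Σ; _×_; _,_; proj₁; proj₂)
open import Data.List using (List; []; _∷_; length; map; _++_; filter; cartesianProduct; applyUpTo; upTo)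
open import Data.List.Properties using (length-++; length-map)
open import Data.List.Membership.Propositional using (_∈_; _∉_; find; lose)
open import Data.List.Membership.Propositional.Properties
  using (∈-++⁺ˡ; ∈-++⁺ʳ; ∈-map⁺; ∈-filter⁺; ∈-cartesianProduct⁺; ∈-applyUpTo⁺; ∈-upTo⁺)
open import Data.List.Membership.DecPropositional _≟_ using (_∈?_)
open import Data.List.Relation.Unary.All using (All; []; _∷_; universal)
import Data.List.Relation.Unary.All.Properties as All
open import Data.List.Relation.Unary.Any using (Any; here; there)
open import Data.List.Relation.Unary.Unique.Propositional using (Unique)
open import Data.List.Relation.Unary.AllPairs using ([]; _∷_)
open import Relation.Binary.PropositionalEquality
open import Relation.Nullary using (¬_; yes; no)

pascal : ∀ m k → suc m C suc k ≡ m C k + m C suc k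
pascal m k = sym (nCk+nC[k+1]≡[n+1]C[k+1] m k)

-- Absorption identity (k+1)·C(m+1,k+1) = (m+1)·C(m,k); it moves a factor
-- of the numerator n of C(n,k) onto the denominator side k.
absorption : ∀ m k → suc k * (suc m C suc k) ≡ suc m * (m C k)
absorption zero zero = refl
absorption zero (suc k)
  rewrite k>n⇒nCk≡0 {1} {suc (suc k)} (s≤s (s≤s z≤n)) | k>n⇒nCk≡0 {0} {suc k} (s≤s z≤n) = *-zeroʳ k
absorption (suc m) zero rewrite nC1≡n (suc (suc m)) = trans (+-identityʳ _) (sym (*-identityʳ _))
absorption (suc m) (suc k) = begin
    suc (suc k) * (suc (suc m) C suc (suc k))      ≡⟨ cong (suc (suc k) *_) (pascal (suc m) (suc k)) ⟩
    suc (suc k) * (A + B)                          ≡⟨ *-distribˡ-+ (suc (suc k)) A B ⟩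
    (A + suc k * A) + suc (suc k) * B              ≡⟨ cong₂ (λ u v → (A + u) + v) (absorption m k) (absorption m (suc k)) ⟩
    (A + suc m * (m C k)) + suc m * (m C suc k)    ≡⟨ +-assoc A _ _ ⟩
    A + (suc m * (m C k) + suc m * (m C suc k))    ≡⟨ cong (λ u → A + u) (sym (*-distribˡ-+ (suc m) (m C k) (m C suc k))) ⟩
    A + suc m * (m C k + m C suc k)                ≡⟨ cong (λ u → A + suc m * u) (sym (pascal m k)) ⟩
    suc (suc m) * A                                ∎
  where
    open ≡-Reasoning
    A = suc m C suc k
    B = suc m C suc (suc k)

C-positive : ∀ n k → k ≤ n → 1 ≤ n C k
C-positive n zero _ = s≤s z≤n
C-positive (suc n) (suc k) (s≤s k≤n) rewrite pascal n k = ≤-trans (C-positive n k k≤n) (m≤m+n _ _)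

C-nontrivial : ∀ n k → 0 < k → k < n → 2 ≤ n C k
C-nontrivial (suc n) (suc zero) _ (s≤s k<n) rewrite nC1≡n (suc n) = s≤s k<n
C-nontrivial (suc n) (suc (suc k)) _ (s≤s k<n) rewrite pascal n (suc k) =
  +-mono-≤ (C-positive n (suc k) (<⇒≤ k<n)) (C-positive n (suc (suc k)) k<n)

-- If p^a ∣ k·X but p^a ∤ k then p ∣ X: strip factors p off k one at a time.
primePower∣product : ∀ {p} → Prime p → ∀ a k X → p ^ a ∣ k * X → ¬ p ^ a ∣ k → p ∣ X
primePower∣product pp zero k X _ pa∤k = ⊥-elim (pa∤k (1∣ k))
primePower∣product {p} pp (suc a) k X pa∣kX pa∤k with p ∣? X
... | yes p∣X = p∣X
... | no _ with euclidsLemma k X pp (∣-trans (m∣m*n (p ^ a)) pa∣kX)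
... | inj₂ p∣X = p∣X
... | inj₁ (divides k′ refl) = primePower∣product pp a k′ X reduced (λ pa∣k′ → pa∤k (lift pa∣k′))
  where
    instance _ = prime⇒nonZero pp
    reduced : p ^ a ∣ k′ * X
    reduced = *-cancelˡ-∣ p (subst (p * p ^ a ∣_) (trans (cong (_* X) (*-comm k′ p)) (*-assoc p k′ X)) pa∣kX)
    lift : p ^ a ∣ k′ → p ^ suc a ∣ k′ * p
    lift pa∣k′ = subst (p * p ^ a ∣_) (*-comm p k′) (*-monoʳ-∣ p pa∣k′)

-- If p^a ∣ n but p^a ∤ k, then p ∣ C(n,k) (a weak form of Kummer's theorem).
p∣C-of-nondivisible : ∀ {p} → Prime p → ∀ a n k → p ^ a ∣ n → ¬ p ^ a ∣ k → p ∣ n C k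
p∣C-of-nondivisible pp a n zero _ pa∤k = ⊥-elim (pa∤k (_ ∣0))
p∣C-of-nondivisible pp a zero (suc k) _ _ rewrite k>n⇒nCk≡0 {0} {suc k} (s≤s z≤n) = _ ∣0
p∣C-of-nondivisible {p} pp a (suc m) (suc k) pa∣n pa∤k =
  primePower∣product pp a (suc k) (suc m C suc k)
    (subst (p ^ a ∣_) (sym (absorption m k)) (∣-trans pa∣n (m∣m*n (m C k)))) pa∤k

∤-nonzeroResidue : ∀ q j g → 0 < g → g < q → ¬ q ∣ j * q + g
∤-nonzeroResidue q j g 0<g g<q q∣ =
  <⇒≱ g<q (∣⇒≤ {{>-nonZero 0<g}} (∣m+n∣m⇒∣n q∣ (n∣m*n j)))

prime∣C-step : ∀ {q m k} → Prime q → ¬ q ∣ suc k → q ∣ suc m * (m C k) → q ∣ suc m C suc k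
prime∣C-step {q} {m} {k} qp q∤ q∣ with euclidsLemma (suc k) (suc m C suc k) qp (subst (q ∣_) (sym (absorption m k)) q∣)
... | inj₁ q∣k+1 = ⊥-elim (q∤ q∣k+1)
... | inj₂ q∣C = q∣C

-- Lucas-type criterion: if n ≡ β and k ≡ γ modulo q with β < γ < q, then
-- q ∣ C(n,k).  Induction on n, lowering β and γ together.
q∣C-aboveResidue : ∀ {q} → Prime q → ∀ d j β γ n → n ≡ d * q + β → β < γ → γ < q → q ∣ n C (j * q + γ)
q∣C-aboveResidue qp d j β zero n _ () _
q∣C-aboveResidue {q} qp d j β (suc γ) zero _ _ _ =
  subst (q ∣_) (sym (k>n⇒nCk≡0 {0} {j * q + suc γ} (subst (0 <_) (sym (+-suc (j * q) γ)) (s≤s z≤n)))) (q ∣0)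
q∣C-aboveResidue {q} qp d j β (suc γ) (suc m) n≡ β<γ γ<q rewrite +-suc (j * q) γ =
  prime∣C-step qp q∤k (q∣numerator β n≡ β<γ)
  where
    q∤k : ¬ q ∣ suc (j * q + γ)
    q∤k q∣ = ∤-nonzeroResidue q j (suc γ) (s≤s z≤n) γ<q (subst (q ∣_) (sym (+-suc (j * q) γ)) q∣)
    q∣numerator : ∀ β → suc m ≡ d * q + β → β < suc γ → q ∣ suc m * (m C (j * q + γ))
    q∣numerator zero m+1≡ _ = ∣-trans (divides d (trans m+1≡ (+-identityʳ _))) (m∣m*n _)
    q∣numerator (suc β′) m+1≡ β<γ = ∣-trans
      (q∣C-aboveResidue qp d j β′ γ m (suc-injective (trans m+1≡ (+-suc _ β′))) (s≤s⁻¹ β<γ) (<-trans (n<1+n γ) γ<q))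
      (n∣m*n (suc m))

-- A prime factor of m when m ≥ 2 (and the prime 2 otherwise).
primeFactor : ∀ m → Σ ℕ λ r → Prime r × (2 ≤ m → r ∣ m)
primeFactor zero = 2 , prime[2] , λ ()
primeFactor (suc zero) = 2 , prime[2] , λ { (s≤s ()) }
primeFactor m@(suc (suc _)) = first (factors F) (isFactorisation F) (factorsPrime F)
  where
    open PrimeFactorisation
    F = factorise m
    first : (fs : List ℕ) → m ≡ product fs → All Prime fs → Σ ℕ λ r → Prime r × (2 ≤ m → r ∣ m)
    first [] ()
    first (r ∷ rs) m≡ (r-prime ∷ _) = r , r-prime , λ _ → subst (r ∣_) (sym m≡) (m∣m*n (product rs))

-- Euclid: a prime factor of 1 + ∏L lies outside any list L of primes.
freshPrime : (L : List ℕ) → All Prime L → Σ ℕ λ r → Prime r × r ∉ L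
freshPrime L L-prime with primeFactor (suc (product L))
... | r , r-prime , r∣ = r , r-prime , λ r∈L → 1≱2 (subst (2 ≤_) (r≡1 r∈L) (nonTrivial⇒n>1 r {{prime⇒nonTrivial r-prime}}))
  where
    1≱2 : ¬ 2 ≤ 1
    1≱2 (s≤s ())
    r≡1 : r ∈ L → r ≡ 1
    r≡1 r∈L = ∣1⇒≡1 (∣m+n∣m⇒∣n {m = product L}
      (subst (r ∣_) (+-comm 1 (product L)) (r∣ (s≤s (productOfPrimes≥1 L-prime)))) (∈⇒∣product r∈L))

distinctPrimes : ∀ L → All Prime L →
  Σ (List ℕ) λ L′ → length L′ ≡ length L × Unique L′ × All Prime L′ × (∀ {r} → r ∈ L → r ∈ L′)
distinctPrimes [] [] = [] , refl , [] , [] , λ ()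
distinctPrimes (x ∷ L) (x-prime ∷ L-prime) with distinctPrimes L L-prime
... | L′ , len , uniq , L′-prime , L⊆L′ with x ∈? L′
... | yes x∈L′ = let (s , s-prime , s∉L′) = freshPrime L′ L′-prime in
  s ∷ L′ , cong suc len , All.¬Any⇒All¬ L′ s∉L′ ∷ uniq , s-prime ∷ L′-prime ,
  λ { (here refl) → there x∈L′ ; (there r∈L) → there (L⊆L′ r∈L) }
... | no x∉L′ =
  x ∷ L′ , cong suc len , All.¬Any⇒All¬ L′ x∉L′ ∷ uniq , x-prime ∷ L′-prime ,
  λ { (here refl) → here refl ; (there r∈L) → there (L⊆L′ r∈L) }

condition1-fromCover : ∀ n (L : List ℕ) → All Prime L →
  (∀ k → 1 ≤ k → k ≤ n ∸ 1 → Any (λ r → r ∣ n C k) L) → Condition1 (length L) n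
condition1-fromCover n L L-prime cover with distinctPrimes L L-prime
... | L′ , len , uniq , L′-prime , L⊆L′ =
  L′ , len , uniq , L′-prime , λ k 1≤k k≤ → let (r , r∈L , r∣) = find (cover k 1≤k k≤) in lose (L⊆L′ r∈L) r∣

solutions : (pa q d δ : ℕ) → List (ℕ × ℕ)
solutions pa q d δ = filter (λ xy → (+ pa ℤ.* + proj₁ xy ℤ.- + q ℤ.* + proj₂ xy) ℤ.≟ + δ)
                            (cartesianProduct (applyUpTo suc (δ + q * (d / 2))) (upTo (suc (d / 2))))

integerDifference : ∀ a b c e δ → a * b ≡ c * e + δ → + a ℤ.* + b ℤ.- + c ℤ.* + e ≡ + δ
integerDifference a b c e δ ab≡ = begin
  + a ℤ.* + b ℤ.- + c ℤ.* + e   ≡⟨ cong₂ (λ u v → u ℤ.- v) (sym (ℤP.pos-* a b)) (sym (ℤP.pos-* c e)) ⟩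
  + (a * b) ℤ.- + (c * e)       ≡⟨ cong (λ u → + u ℤ.- + (c * e)) ab≡ ⟩
  + (c * e + δ) ℤ.- + (c * e)   ≡⟨ ℤP.[+m]-[+n]≡m⊖n (c * e + δ) (c * e) ⟩
  (c * e + δ) ℤ.⊖ (c * e)       ≡⟨ sym (ℤP.distribˡ-⊖-+-pos δ (c * e) (c * e)) ⟩
  (c * e) ℤ.⊖ (c * e) ℤ.+ + δ   ≡⟨ cong (ℤ._+ + δ) (ℤP.n⊖n≡0 (c * e)) ⟩
  + δ                            ∎
  where open ≡-Reasoning

solutions-complete : ∀ pa q d {x y δ} .{{_ : NonZero pa}} →
  pa * suc x ≡ q * y + δ → y ≤ d / 2 → (suc x , y) ∈ solutions pa q d δ
solutions-complete pa q d {x} {y} {δ} eqn y≤h =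
  ∈-filter⁺ (λ xy → (+ pa ℤ.* + proj₁ xy ℤ.- + q ℤ.* + proj₂ xy) ℤ.≟ + δ)
    (∈-cartesianProduct⁺ (∈-applyUpTo⁺ suc x<) (∈-upTo⁺ (s≤s y≤h)))
    (integerDifference pa (suc x) q y δ eqn)
  where
    open ≤-Reasoning
    x< : x < δ + q * (d / 2)
    x< = begin-strict
      x                <⟨ n<1+n x ⟩
      suc x            ≤⟨ m≤n*m (suc x) pa ⟩
      pa * suc x       ≡⟨ trans eqn (+-comm (q * y) δ) ⟩
      δ + q * y        ≤⟨ +-monoʳ-≤ δ (*-monoʳ-≤ q y≤h) ⟩
      δ + q * (d / 2)  ∎

attachedPrime : (n pa : ℕ) → ℕ × ℕ → ℕ
attachedPrime n pa xy = proj₁ (primeFactor (n C (pa * proj₁ xy)))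

solutionPrimes : (n pa q d : ℕ) → List ℕ → List ℕ
solutionPrimes n pa q d [] = []
solutionPrimes n pa q d (δ ∷ δs) = map (attachedPrime n pa) (solutions pa q d δ) ++ solutionPrimes n pa q d δs

solutionPrimes-length : ∀ n pa q d δs → length (solutionPrimes n pa q d δs) ≡ sum (map (solutionCount pa q d) δs)
solutionPrimes-length n pa q d [] = refl
solutionPrimes-length n pa q d (δ ∷ δs) =
  trans (length-++ (map _ (solutions pa q d δ)))
        (cong₂ _+_ (length-map _ (solutions pa q d δ)) (solutionPrimes-length n pa q d δs))

solutionPrimes-prime : ∀ n pa q d δs → All Prime (solutionPrimes n pa q d δs)
solutionPrimes-prime n pa q d [] = []
solutionPrimes-prime n pa q d (δ ∷ δs) =
  All.++⁺ (All.map⁺ (universal (λ xy → proj₁ (proj₂ (primeFactor (n C (pa * proj₁ xy))))) (solutions pa q d δ)))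
          (solutionPrimes-prime n pa q d δs)

solutionPrimes-cover : ∀ n pa q d {k y δ δs} .{{_ : NonZero pa}} → pa ∣ k → 1 ≤ k → k < n →
  k ≡ q * y + δ → δ ∈ δs → y ≤ d / 2 → Any (λ r → r ∣ n C k) (solutionPrimes n pa q d δs)
solutionPrimes-cover n pa q d (divides zero refl) () _ _ _ _
solutionPrimes-cover n pa q d {k} {y} {δ} (divides (suc x) refl) 1≤k k<n k≡ δ∈ y≤h =
  lose (attached δ∈) (proj₂ (proj₂ (primeFactor (n C k))) (C-nontrivial n k 1≤k k<n))
  where
    k≡pa·x : k ≡ pa * suc x
    k≡pa·x = *-comm (suc x) pa
    attached : ∀ {δs} → δ ∈ δs → proj₁ (primeFactor (n C k)) ∈ solutionPrimes n pa q d δs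
    attached {δ ∷ _} (here refl) = ∈-++⁺ˡ
      (subst (λ z → proj₁ (primeFactor (n C z)) ∈ map (attachedPrime n pa) (solutions pa q d δ)) (sym k≡pa·x)
        (∈-map⁺ (attachedPrime n pa) (solutions-complete pa q d (trans (sym k≡pa·x) k≡) y≤h)))
    attached {δ′ ∷ _} (there δ∈) = ∈-++⁺ʳ (map _ (solutions pa q d δ′)) (attached δ∈)

complementForm : ∀ {j d γ β} q → j ≤ d → γ ≤ β → (d * q + β) ∸ (j * q + γ) ≡ (d ∸ j) * q + (β ∸ γ)
complementForm {j} {d} {γ} {β} q j≤d γ≤β = begin
  (d * q + β) ∸ (j * q + γ)               ≡⟨ cong₂ (λ u v → (u * q + v) ∸ (j * q + γ)) (sym (m+[n∸m]≡n j≤d)) (sym (m+[n∸m]≡n γ≤β)) ⟩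
  ((j + e) * q + (γ + t)) ∸ (j * q + γ)   ≡⟨ cong (_∸ (j * q + γ)) (regroup j e q γ t) ⟩
  ((j * q + γ) + (e * q + t)) ∸ (j * q + γ) ≡⟨ m+n∸m≡n (j * q + γ) (e * q + t) ⟩
  e * q + t                               ∎
  where
    open ≡-Reasoning
    open +-*-Solver
    e = d ∸ j
    t = β ∸ γ
    regroup : ∀ j e q γ t → (j + e) * q + (γ + t) ≡ (j * q + γ) + (e * q + t)
    regroup = solve 5 (λ j e q γ t → (j :+ e) :* q :+ (γ :+ t) := (j :* q :+ γ) :+ (e :* q :+ t)) refl

≤2[d/2]+1 : ∀ d → d ≤ suc (d / 2) + d / 2
≤2[d/2]+1 d = begin
  d                   ≡⟨ m≡m%n+[m/n]*n d 2 ⟩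
  d % 2 + h * 2       ≤⟨ +-monoˡ-≤ (h * 2) (s≤s⁻¹ (m%n<n d 2)) ⟩
  1 + h * 2           ≡⟨ cong suc (trans (*-comm h 2) (cong (λ u → h + u) (+-identityʳ h))) ⟩
  suc h + h           ∎
  where
    open ≤-Reasoning
    h = d / 2

module Covering (n d q p a : ℕ) (pp : Prime p) (qp : Prime q) (pa∣n : p ^ a ∣ n)
                (qd<n : q * d < n) (n<q[d+1] : n < q * suc d) where

  pa = p ^ a
  h = d / 2
  β = n ∸ d * q

  instance
    pa≢0 : NonZero pa
    pa≢0 = m^n≢0 p a {{prime⇒nonZero pp}}
    q≢0 : NonZero q
    q≢0 = prime⇒nonZero qp

  primes : List ℕ
  primes = p ∷ q ∷ solutionPrimes n pa q d (upTo (suc β))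

  Covered : ℕ → Set
  Covered k = Any (λ r → r ∣ n C k) primes

  n≡dq+β : n ≡ d * q + β
  n≡dq+β = sym (m+[n∸m]≡n (<⇒≤ (subst (_< n) (*-comm q d) qd<n)))

  k≡[k/q]q+k%q : ∀ k → k ≡ k / q * q + k % q
  k≡[k/q]q+k%q k = trans (m≡m%n+[m/n]*n k q) (+-comm (k % q) _)

  covered-small : ∀ k j γ → pa ∣ k → 1 ≤ k → k < n → k ≡ j * q + γ → γ ≤ β → j ≤ h → Covered k
  covered-small k j γ pa∣k 1≤k k<n k≡ γ≤β j≤h = there (there
    (solutionPrimes-cover n pa q d pa∣k 1≤k k<n (trans k≡ (cong (_+ γ) (*-comm j q))) (∈-upTo⁺ (s≤s γ≤β)) j≤h))

  -- Case j > h: n - k = (d-j)·q + (β-γ) with d - j ≤ h, and C(n,k) = C(n,n-k).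
  covered-large : ∀ k j γ → pa ∣ k → 1 ≤ k → k < n → k ≡ j * q + γ → γ ≤ β → h < j → Covered k
  covered-large k j γ pa∣k 1≤k k<n k≡ γ≤β h<j =
    subst (λ z → Any (λ r → r ∣ z) primes) (sym (nCk≡nC[n∸k] (<⇒≤ k<n)))
      (covered-small (n ∸ k) (d ∸ j) (β ∸ γ) pa∣n∸k (m<n⇒0<n∸m k<n) (∸-monoʳ-< 1≤k (<⇒≤ k<n))
        n∸k≡ (m∸n≤m β γ) d∸j≤h)
    where
      open ≤-Reasoning
      j≤d : j ≤ d
      j≤d = s≤s⁻¹ (*-cancelˡ-< q j (suc d) (begin-strict
        q * j         ≤⟨ m≤m+n (q * j) γ ⟩
        q * j + γ     ≡⟨ cong (_+ γ) (*-comm q j) ⟩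
        j * q + γ     ≡⟨ sym k≡ ⟩
        k             <⟨ k<n ⟩
        n             <⟨ n<q[d+1] ⟩
        q * suc d     ∎))
      n∸k≡ : n ∸ k ≡ (d ∸ j) * q + (β ∸ γ)
      n∸k≡ = trans (cong₂ _∸_ n≡dq+β k≡) (complementForm q j≤d γ≤β)
      pa∣n∸k : pa ∣ n ∸ k
      pa∣n∸k = ∣m+n∣m⇒∣n (subst (pa ∣_) (sym (m+[n∸m]≡n (<⇒≤ k<n))) pa∣n) pa∣k
      d∸j≤h : d ∸ j ≤ h
      d∸j≤h = ≤-trans (∸-monoʳ-≤ d h<j) (m≤n+o⇒m∸n≤o d (suc h) (≤2[d/2]+1 d))

  covered : ∀ k → 1 ≤ k → k < n → Covered k
  covered k 1≤k k<n with pa ∣? k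
  ... | no pa∤k = here (p∣C-of-nondivisible pp a n k pa∣n pa∤k)
  ... | yes pa∣k with k % q ≤? β
  ... | no γ≰β = there (here (subst (λ z → q ∣ n C z) (sym (k≡[k/q]q+k%q k))
                   (q∣C-aboveResidue qp d (k / q) β (k % q) n n≡dq+β (≰⇒> γ≰β) (m%n<n k q))))
  ... | yes γ≤β with k / q ≤? h
  ... | yes j≤h = covered-small k (k / q) (k % q) pa∣k 1≤k k<n (k≡[k/q]q+k%q k) γ≤β j≤h
  ... | no j≰h = covered-large k (k / q) (k % q) pa∣k 1≤k k<n (k≡[k/q]q+k%q k) γ≤β (≰⇒> j≰h)

  primes-length : length primes ≡ 2 + solutionSum pa q d β
  primes-length = cong (λ z → suc (suc z)) (solutionPrimes-length n pa q d (upTo (suc β)))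

  primes-prime : All Prime primes
  primes-prime = pp ∷ qp ∷ solutionPrimes-prime n pa q d (upTo (suc β))

  result : Condition1 (2 + solutionSum pa q d β) n
  result = subst (λ N → Condition1 N n) primes-length
    (condition1-fromCover n primes primes-prime
      (λ k 1≤k k≤n-1 → covered k 1≤k (≤-<-trans k≤n-1 (∸-monoʳ-< {n} {1} {0} (s≤s z≤n) (≤-trans (s≤s z≤n) qd<n)))))

-- Theorem 4.5.  Only q·d < n < q·(d+1), primality of p and q, and p^a ∣ n
-- are used.

theorem4p5 : (n d q p a : ℕ) → 1 ≤ n → 1 ≤ d →
    IsLargestPrimeBelow n d q → n < q * (suc d) →
    Prime p → 1 ≤ a → p ^ a ∣ n → ¬ (p ≡ q) →
    Condition1 (2 + solutionSum (p ^ a) q d (n ∸ d * q)) n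
theorem4p5 n d q p a _ _ (q-prime , qd<n , _) n<q[d+1] p-prime _ pa∣n _ =
  Covering.result n d q p a p-prime q-prime pa∣n qd<n n<q[d+1]
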